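{- Fix an integer $k\ge 6$. Let $f_k:\mathbb{Z}_{>0}\to\mathbb{C}$ be a multiplicative function such that $f_k(a_1^2+\dots+a_k^2)=f_k(a_1^2)+\dots+f_k(a_k^2)$ for all positive integers $a_1,\dots,a_k$. Then $f_k(n^2)=n^2$ for $n=2,3,4$.
   Context: A function $f$ on the positive integers is multiplicative if $f(1)=1$ and $f(mn)=f(m)f(n)$ whenever $\gcd(m,n)=1$. -}

module Defs where

open import Level using (_⊔_)
open import Algebra.Bundles using (CommutativeRing)
open import Data.Nat using (ℕ; zero; suc; _^_; _<_)
import Data.Nat as ℕ
open import Data.Nat.Coprimality using (Coprime)
open import Data.Fin using (Fin)
import Data.Fin as Fin
open import Data.Sum using (_⊎_)
import Data.Empty
open import Relation.Binary.PropositionalEquality using (_≡_)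

sumℕ : (k : ℕ) → (Fin k → ℕ) → ℕ
sumℕ zero    a = 0
sumℕ (suc k) a = a Fin.zero ℕ.+ sumℕ k (λ i → a (Fin.suc i))

module _ {c ℓ} (R : CommutativeRing c ℓ) where
  open CommutativeRing R

  fromℕ : ℕ → Carrier
  fromℕ zero    = 0#
  fromℕ (suc n) = 1# + fromℕ n

  sumR : (k : ℕ) → (Fin k → Carrier) → Carrier
  sumR zero    a = 0#
  sumR (suc k) a = a Fin.zero + sumR k (λ i → a (Fin.suc i))

  -- R is an integral domain of characteristic zero (e.g. ℂ).
  record IsCharZeroDomain : Set (c ⊔ ℓ) where
    field
      nontrivial      : 1# ≈ 0# → Data.Empty.⊥
      noZeroDivisors  : ∀ x y → x * y ≈ 0# → x ≈ 0# ⊎ y ≈ 0#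
      charZero        : ∀ n → fromℕ n ≈ 0# → n ≡ 0

  -- f is multiplicative on the positive integers (values of f at 0 are irrelevant).
  Multiplicative : (ℕ → Carrier) → Set ℓ
  Multiplicative f =
    (f 1 ≈ 1#) ×′
    (∀ m n → 0 < m → 0 < n → Coprime m n → f (m ℕ.* n) ≈ f m * f n)
    where open import Data.Product renaming (_×_ to _×′_)

  SumOfSquaresAdditive : ℕ → (ℕ → Carrier) → Set ℓ
  SumOfSquaresAdditive k f =
    (a : Fin k → ℕ) → (∀ i → 0 < a i) →
    f (sumℕ k (λ i → a i ^ 2)) ≈ sumR k (λ i → f (a i ^ 2))

-- Padding with ones turns the hypothesis into identities between sums of six squares.
-- Four of them, 16+5 = 5·4+1, 25+5 = 3·9+3, 25+5 = 3·4+16+2 and 36+5 = 4+4·9+1,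
-- together with f(36) = f(4) f(9), force 8 (f(4) − 1)(f(4) − 4) = 0.
-- If f(4) = 4 the same identities give f(9) = 9 and f(16) = 16.
-- If f(4) = 1 then f is 1 at 1, 4, 9, 16 and 36. Put X = 20 + n, where k = 6 + n:
-- each of X, X+1, X+2, X+3 is a sum of k such squares, so f takes the value k there,
-- while X(X+1) − X², (X+2)(X+3) − (X+2)² and (X+2)² − X² are sums of k − 1 of them.
-- Computing f(X(X+1)) and f((X+2)(X+3)) multiplicatively and additively then gives
-- k − 1 = 0, impossible in characteristic zero.
module Submission where

open import Defs
open import Algebra.Bundles using (CommutativeRing)
open import Data.Nat using (ℕ; _≤_; _^_)
open import Data.Product using (_×_)

open import Data.Nat using (zero; suc; _<_; z≤n; s≤s)
import Data.Nat as ℕ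
open import Data.Nat.Properties using (_<?_)
import Data.Nat.Properties as ℕₚ
open import Data.Nat.Coprimality using (Coprime; coprime-+; 1-coprimeTo)
import Data.Nat.Coprimality as Coprime
open import Data.Nat.Solver using (module +-*-Solver)
open import Data.Vec using (Vec; []; _∷_; _++_; replicate; lookup)
open import Data.Vec.Relation.Unary.All using (All; []; _∷_; all?)
open import Data.Vec.Relation.Unary.All.Properties using (lookup⁺; ++⁺)
open import Data.Product using (_,_; proj₁; proj₂)
open import Data.Sum using (_⊎_; inj₁; inj₂; [_,_]′)
import Data.Sum as Sum
open import Data.Empty using (⊥-elim)
open import Function using (_∘_; id)
open import Relation.Nullary using (¬_)
open import Relation.Nullary.Decidable using (True; toWitness)
open import Relation.Binary.PropositionalEquality as ≡ using (_≡_)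

private
  variable
    i j p q t : ℕ

positive : {as : Vec ℕ i} {_ : True (all? (0 <?_) as)} → All (0 <_) as
positive {_} {as} {as>0} = toWitness as>0

replicate-positive : 0 < p → All (0 <_) (replicate t p)
replicate-positive {t = zero}  p>0 = []
replicate-positive {t = suc t} p>0 = p>0 ∷ replicate-positive p>0

coprime-suc : ∀ x → Coprime x (suc x)
coprime-suc x = Coprime.sym (≡.subst (λ y → Coprime y x) (ℕₚ.+-comm x 1) (coprime-+ (1-coprimeTo x)))

x*[1+x]≡x^2+x : ∀ x → x ℕ.* suc x ≡ x ^ 2 ℕ.+ x
x*[1+x]≡x^2+x = solve 1 (λ x → x :* (con 1 :+ x) := x :^ 2 :+ x) ≡.refl
  where open +-*-Solver

[2+x]^2≡x^2+[4+x*4] : ∀ x → (2 ℕ.+ x) ^ 2 ≡ x ^ 2 ℕ.+ (4 ℕ.+ x ℕ.* 4)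
[2+x]^2≡x^2+[4+x*4] = solve 1 (λ x → (con 2 :+ x) :^ 2 := x :^ 2 :+ (con 4 :+ x :* con 4)) ≡.refl
  where open +-*-Solver

sumSq : Vec ℕ i → ℕ
sumSq {i} as = sumℕ i (λ j → lookup as j ^ 2)

sumSq-++ : (as : Vec ℕ i) (bs : Vec ℕ j) → sumSq (as ++ bs) ≡ sumSq as ℕ.+ sumSq bs
sumSq-++ []       bs = ≡.refl
sumSq-++ (a ∷ as) bs = ≡.trans (≡.cong (a ^ 2 ℕ.+_) (sumSq-++ as bs)) (≡.sym (ℕₚ.+-assoc (a ^ 2) _ _))

sumSq-replicate : ∀ t p → sumSq (replicate t p) ≡ t ℕ.* p ^ 2
sumSq-replicate zero    p = ≡.refl
sumSq-replicate (suc t) p = ≡.cong (p ^ 2 ℕ.+_) (sumSq-replicate t p)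

module _ {c ℓ} (R : CommutativeRing c ℓ) where
  open CommutativeRing R

  fromℕ-+ : ∀ m n → fromℕ R (m ℕ.+ n) ≈ fromℕ R m + fromℕ R n
  fromℕ-+ zero    n = sym (+-identityˡ _)
  fromℕ-+ (suc m) n = trans (+-congˡ (fromℕ-+ m n)) (sym (+-assoc _ _ _))

module CharZeroDomainProperties {c ℓ} (R : CommutativeRing c ℓ) (D : IsCharZeroDomain R) where
  open CommutativeRing R
  open IsCharZeroDomain D
  open import Algebra.Properties.Group +-group using (x∙y⁻¹≈ε⇒x≈y; x≈y⇒x∙y⁻¹≈ε; ⁻¹-involutive)
  open import Algebra.Properties.Ring ring using (-1*x≈-x; x[y-z]≈xy-xz)
  open import Algebra.Solver.Ring.NaturalCoefficients.Default commutativeSemiring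
  open import Relation.Binary.Reasoning.Setoid setoid

  fromℕ-suc≉0 : ∀ k → ¬ (fromℕ R (suc k) ≈ 0#)
  fromℕ-suc≉0 k eq with charZero (suc k) eq
  ... | ()

  *-cancelˡ-fromℕ-suc : ∀ k {x y} → fromℕ R (suc k) * x ≈ fromℕ R (suc k) * y → x ≈ y
  *-cancelˡ-fromℕ-suc k {x} {y} eq
    with noZeroDivisors _ _ (trans (x[y-z]≈xy-xz _ x y) (x≈y⇒x∙y⁻¹≈ε eq))
  ... | inj₁ k+1≈0 = ⊥-elim (fromℕ-suc≉0 k k+1≈0)
  ... | inj₂ x-y≈0 = x∙y⁻¹≈ε⇒x≈y x y x-y≈0

  x*x+a*b≈[a+b]*x⇒x≈a⊎x≈b : ∀ {x a b} → x * x + a * b ≈ (a + b) * x → x ≈ a ⊎ x ≈ b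
  x*x+a*b≈[a+b]*x⇒x≈a⊎x≈b {x} {a} {b} eq =
    Sum.map (x∙y⁻¹≈ε⇒x≈y x a) (x∙y⁻¹≈ε⇒x≈y x b) (noZeroDivisors _ _ [x-a][x-b]≈0)
    where
    -- The semiring solver cannot see negation, so -1 enters it as a variable m with m * m ≈ 1.
    m : Carrier
    m = - 1#

    m*m≈1 : m * m ≈ 1#
    m*m≈1 = trans (-1*x≈-x m) (⁻¹-involutive 1#)

    [x-a][x-b]≈0 : (x - a) * (x - b) ≈ 0#
    [x-a][x-b]≈0 = begin
      (x - a) * (x - b)
        ≈⟨ *-cong (+-congˡ (-1*x≈-x a)) (+-congˡ (-1*x≈-x b)) ⟨
      (x + m * a) * (x + m * b)
        ≈⟨ solve 4 (λ x a b m → (x :+ m :* a) :* (x :+ m :* b)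
                               := x :* x :+ (m :* m) :* (a :* b) :+ m :* ((a :+ b) :* x)) refl x a b m ⟩
      x * x + (m * m) * (a * b) + m * ((a + b) * x)
        ≈⟨ +-congʳ (+-congˡ (trans (*-congʳ m*m≈1) (*-identityˡ _))) ⟩
      x * x + a * b + m * ((a + b) * x)
        ≈⟨ +-congʳ eq ⟩
      (a + b) * x + m * ((a + b) * x)
        ≈⟨ solve 2 (λ y m → y :+ m :* y := (con 1 :+ m) :* y) refl ((a + b) * x) m ⟩
      (1# + m) * ((a + b) * x)
        ≈⟨ *-congʳ (-‿inverseʳ 1#) ⟩
      0# * ((a + b) * x)
        ≈⟨ zeroˡ _ ⟩
      0# ∎

module SquareSums {c ℓ} (R : CommutativeRing c ℓ) (f : ℕ → CommutativeRing.Carrier R) where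
  open CommutativeRing R
  open import Relation.Binary.Reasoning.Setoid setoid

  sumFSq : Vec ℕ i → Carrier
  sumFSq {i} as = sumR R i (λ j → f (lookup as j ^ 2))

  sumFSq-++ : (as : Vec ℕ i) (bs : Vec ℕ j) → sumFSq (as ++ bs) ≈ sumFSq as + sumFSq bs
  sumFSq-++ []       bs = sym (+-identityˡ _)
  sumFSq-++ (a ∷ as) bs = trans (+-congˡ (sumFSq-++ as bs)) (sym (+-assoc _ _ _))

  sumFSq-units : {as : Vec ℕ i} → All (λ a → f (a ^ 2) ≈ 1#) as → sumFSq as ≈ fromℕ R i
  sumFSq-units []           = refl
  sumFSq-units (fa≈1 ∷ fas) = +-cong fa≈1 (sumFSq-units fas)

  sumFSq-replicate : f (p ^ 2) ≈ 1# → ∀ t → sumFSq (replicate t p) ≈ fromℕ R t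
  sumFSq-replicate fp≈1 zero    = refl
  sumFSq-replicate fp≈1 (suc t) = +-cong fp≈1 (sumFSq-replicate fp≈1 t)

  f-padded : SumOfSquaresAdditive R (i ℕ.+ t) f → (as : Vec ℕ i) → All (0 <_) as → ∀ p → 0 < p →
             f (sumSq as ℕ.+ t ℕ.* p ^ 2) ≈ sumFSq as + sumFSq (replicate t p)
  f-padded {t = t} additive as as>0 p p>0 = begin
    f (sumSq as ℕ.+ t ℕ.* p ^ 2)       ≡⟨ ≡.cong f padded-sum ⟨
    f (sumSq (as ++ replicate t p))    ≈⟨ additive (lookup (as ++ replicate t p))
                                           (lookup⁺ (++⁺ as>0 (replicate-positive p>0))) ⟩
    sumFSq (as ++ replicate t p)       ≈⟨ sumFSq-++ as _ ⟩
    sumFSq as + sumFSq (replicate t p) ∎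
    where
    padded-sum : sumSq (as ++ replicate t p) ≡ sumSq as ℕ.+ t ℕ.* p ^ 2
    padded-sum = ≡.trans (sumSq-++ as _) (≡.cong (sumSq as ℕ.+_) (sumSq-replicate t p))

module FirstValues {c ℓ} (R : CommutativeRing c ℓ) (D : IsCharZeroDomain R)
  (f : ℕ → CommutativeRing.Carrier R) (multiplicative : Multiplicative R f)
  (n : ℕ) (additive : SumOfSquaresAdditive R (6 ℕ.+ n) f) where

  open CommutativeRing R
  open CharZeroDomainProperties R D
  open SquareSums R f
  open import Algebra.Properties.Group +-group using (∙-cancelˡ; ∙-cancelʳ)
  open import Algebra.Solver.Ring.NaturalCoefficients.Default commutativeSemiring
  open import Relation.Binary.Reasoning.Setoid setoid

  ι : ℕ → Carrier
  ι = fromℕ R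

  -- ⟦ num k ⟧ unfolds definitionally to fromℕ R k, which the solver's constants do not.
  num : ∀ {m} → ℕ → Polynomial m
  num zero    = con 0
  num (suc k) = con 1 :+ num k

  f-cong : ∀ {a b} → a ≡ b → f a ≈ f b
  f-cong a≡b = reflexive (≡.cong f a≡b)

  f1≈1 : f 1 ≈ 1#
  f1≈1 = proj₁ multiplicative

  f-consecutive : ∀ x → 0 < x → f (x ℕ.* suc x) ≈ f x * f (suc x)
  f-consecutive x x>0 = proj₂ multiplicative x (suc x) x>0 (s≤s z≤n) (coprime-suc x)

  f36≈f4*f9 : f 36 ≈ f 4 * f 9
  f36≈f4*f9 = proj₂ multiplicative 4 9 (s≤s z≤n) (s≤s z≤n) coprime-4-9
    where
    coprime-4-9 : Coprime 4 9
    coprime-4-9 = Coprime.sym (coprime-+ (coprime-+ (1-coprimeTo 4)))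

  f-padded-units : (as : Vec ℕ i) → All (0 <_) as → ∀ p → 0 < p → f (p ^ 2) ≈ 1# →
                   i ℕ.+ t ≡ 6 ℕ.+ n →
                   f (sumSq as ℕ.+ t ℕ.* p ^ 2) ≈ sumFSq as + ι t
  f-padded-units {i} {t} as as>0 p p>0 fp≈1 i+t≡6+n = begin
    f (sumSq as ℕ.+ t ℕ.* p ^ 2)        ≈⟨ f-padded additive′ as as>0 p p>0 ⟩
    sumFSq as + sumFSq (replicate t p)  ≈⟨ +-congˡ (sumFSq-replicate fp≈1 t) ⟩
    sumFSq as + ι t                     ∎
    where
    additive′ : SumOfSquaresAdditive R (i ℕ.+ t) f
    additive′ = ≡.subst (λ k → SumOfSquaresAdditive R k f) (≡.sym i+t≡6+n) additive

  f-padded-ones : (as : Vec ℕ i) → All (0 <_) as → i ℕ.+ t ≡ 6 ℕ.+ n →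
                  f (sumSq as ℕ.+ t) ≈ sumFSq as + ι t
  f-padded-ones {t = t} as as>0 i+t≡6+n = begin
    f (sumSq as ℕ.+ t)            ≡⟨ ≡.cong (λ s → f (sumSq as ℕ.+ s)) (ℕₚ.*-identityʳ t) ⟨
    f (sumSq as ℕ.+ t ℕ.* 1 ^ 2)  ≈⟨ f-padded-units as as>0 1 (s≤s z≤n) f1≈1 i+t≡6+n ⟩
    sumFSq as + ι t               ∎

  f-balanced : (as : Vec ℕ i) (bs : Vec ℕ j) → All (0 <_) as → All (0 <_) bs →
               i ℕ.+ p ≡ 6 → j ℕ.+ q ≡ 6 → sumSq as ℕ.+ p ≡ sumSq bs ℕ.+ q →
               sumFSq as + ι p ≈ sumFSq bs + ι q
  f-balanced {p = p} {q = q} as bs as>0 bs>0 i+p≡6 j+q≡6 eq = ∙-cancelʳ (ι n) _ _ (begin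
    sumFSq as + ι p + ι n     ≈⟨ padded as as>0 i+p≡6 ⟨
    f (sumSq as ℕ.+ p ℕ.+ n)  ≡⟨ ≡.cong (λ s → f (s ℕ.+ n)) eq ⟩
    f (sumSq bs ℕ.+ q ℕ.+ n)  ≈⟨ padded bs bs>0 j+q≡6 ⟩
    sumFSq bs + ι q + ι n     ∎)
    where
    padded : ∀ {k r} (cs : Vec ℕ k) → All (0 <_) cs → k ℕ.+ r ≡ 6 →
             f (sumSq cs ℕ.+ r ℕ.+ n) ≈ sumFSq cs + ι r + ι n
    padded {k} {r} cs cs>0 k+r≡6 = begin
      f (sumSq cs ℕ.+ r ℕ.+ n)    ≡⟨ ≡.cong f (ℕₚ.+-assoc (sumSq cs) r n) ⟩
      f (sumSq cs ℕ.+ (r ℕ.+ n))  ≈⟨ f-padded-ones cs cs>0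
                                      (≡.trans (≡.sym (ℕₚ.+-assoc k r n)) (≡.cong (ℕ._+ n) k+r≡6)) ⟩
      sumFSq cs + ι (r ℕ.+ n)     ≈⟨ +-congˡ (fromℕ-+ R r n) ⟩
      sumFSq cs + (ι r + ι n)     ≈⟨ +-assoc _ _ _ ⟨
      sumFSq cs + ι r + ι n       ∎

  f16-relation : sumFSq (4 ∷ []) + ι 5 ≈ sumFSq (2 ∷ 2 ∷ 2 ∷ 2 ∷ 2 ∷ []) + ι 1
  f16-relation = f-balanced (4 ∷ []) (2 ∷ 2 ∷ 2 ∷ 2 ∷ 2 ∷ []) positive positive ≡.refl ≡.refl ≡.refl

  f25-relation₁ : sumFSq (5 ∷ []) + ι 5 ≈ sumFSq (3 ∷ 3 ∷ 3 ∷ []) + ι 3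
  f25-relation₁ = f-balanced (5 ∷ []) (3 ∷ 3 ∷ 3 ∷ []) positive positive ≡.refl ≡.refl ≡.refl

  f25-relation₂ : sumFSq (5 ∷ []) + ι 5 ≈ sumFSq (2 ∷ 2 ∷ 2 ∷ 4 ∷ []) + ι 2
  f25-relation₂ = f-balanced (5 ∷ []) (2 ∷ 2 ∷ 2 ∷ 4 ∷ []) positive positive ≡.refl ≡.refl ≡.refl

  f36-relation : sumFSq (6 ∷ []) + ι 5 ≈ sumFSq (2 ∷ 3 ∷ 3 ∷ 3 ∷ 3 ∷ []) + ι 1
  f36-relation = f-balanced (6 ∷ []) (2 ∷ 3 ∷ 3 ∷ 3 ∷ 3 ∷ []) positive positive ≡.refl ≡.refl ≡.refl

  f16+4≈5*f4 : f 16 + ι 4 ≈ ι 5 * f 4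
  f16+4≈5*f4 = ∙-cancelʳ 1# _ _ (begin
    f 16 + ι 4 + 1#
      ≈⟨ solve 1 (λ w → w :+ num 4 :+ con 1 := w :+ con 0 :+ num 5) refl (f 16) ⟩
    sumFSq (4 ∷ []) + ι 5
      ≈⟨ f16-relation ⟩
    sumFSq (2 ∷ 2 ∷ 2 ∷ 2 ∷ 2 ∷ []) + ι 1
      ≈⟨ solve 1 (λ u → u :+ (u :+ (u :+ (u :+ (u :+ con 0)))) :+ num 1 := num 5 :* u :+ con 1) refl (f 4) ⟩
    ι 5 * f 4 + 1# ∎)

  3*f9+5≈8*f4 : ι 3 * f 9 + ι 5 ≈ ι 8 * f 4
  3*f9+5≈8*f4 = ∙-cancelʳ (f 16 + ι 3) _ _ (begin
    ι 3 * f 9 + ι 5 + (f 16 + ι 3)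
      ≈⟨ solve 2 (λ v w → num 3 :* v :+ num 5 :+ (w :+ num 3)
                        := v :+ (v :+ (v :+ con 0)) :+ num 3 :+ (w :+ con 0 :+ num 5)) refl (f 9) (f 16) ⟩
    sumFSq (3 ∷ 3 ∷ 3 ∷ []) + ι 3 + (sumFSq (4 ∷ []) + ι 5)
      ≈⟨ +-cong (trans (sym f25-relation₁) f25-relation₂) f16-relation ⟩
    sumFSq (2 ∷ 2 ∷ 2 ∷ 4 ∷ []) + ι 2 + (sumFSq (2 ∷ 2 ∷ 2 ∷ 2 ∷ 2 ∷ []) + ι 1)
      ≈⟨ solve 2 (λ u w → u :+ (u :+ (u :+ (w :+ con 0))) :+ num 2
                          :+ (u :+ (u :+ (u :+ (u :+ (u :+ con 0)))) :+ num 1)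
                        := num 8 :* u :+ (w :+ num 3)) refl (f 4) (f 16) ⟩
    ι 8 * f 4 + (f 16 + ι 3) ∎)

  f4*f9+4≈f4+4*f9 : f 4 * f 9 + ι 4 ≈ f 4 + ι 4 * f 9
  f4*f9+4≈f4+4*f9 = ∙-cancelʳ 1# _ _ (begin
    f 4 * f 9 + ι 4 + 1#
      ≈⟨ +-congʳ (+-congʳ f36≈f4*f9) ⟨
    f 36 + ι 4 + 1#
      ≈⟨ solve 1 (λ s → s :+ num 4 :+ con 1 := s :+ con 0 :+ num 5) refl (f 36) ⟩
    sumFSq (6 ∷ []) + ι 5
      ≈⟨ f36-relation ⟩
    sumFSq (2 ∷ 3 ∷ 3 ∷ 3 ∷ 3 ∷ []) + ι 1
      ≈⟨ solve 2 (λ u v → u :+ (v :+ (v :+ (v :+ (v :+ con 0)))) :+ num 1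
                        := u :+ num 4 :* v :+ con 1) refl (f 4) (f 9) ⟩
    f 4 + ι 4 * f 9 + 1# ∎)

  f4-quadratic : f 4 * f 4 + 1# * ι 4 ≈ (1# + ι 4) * f 4
  f4-quadratic = *-cancelˡ-fromℕ-suc 7 (begin
    ι 8 * (f 4 * f 4 + 1# * ι 4)
      ≈⟨ solve 1 (λ u → num 8 :* (u :* u :+ con 1 :* num 4) := u :* (num 8 :* u) :+ num 32) refl (f 4) ⟩
    f 4 * (ι 8 * f 4) + ι 32
      ≈⟨ +-congʳ (*-congˡ 3*f9+5≈8*f4) ⟨
    f 4 * (ι 3 * f 9 + ι 5) + ι 32
      ≈⟨ solve 2 (λ u v → u :* (num 3 :* v :+ num 5) :+ num 32
                        := num 3 :* (u :* v :+ num 4) :+ num 5 :* u :+ num 20) refl (f 4) (f 9) ⟩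
    ι 3 * (f 4 * f 9 + ι 4) + ι 5 * f 4 + ι 20
      ≈⟨ +-congʳ (+-congʳ (*-congˡ f4*f9+4≈f4+4*f9)) ⟩
    ι 3 * (f 4 + ι 4 * f 9) + ι 5 * f 4 + ι 20
      ≈⟨ solve 2 (λ u v → num 3 :* (u :+ num 4 :* v) :+ num 5 :* u :+ num 20
                        := num 8 :* u :+ num 4 :* (num 3 :* v :+ num 5)) refl (f 4) (f 9) ⟩
    ι 8 * f 4 + ι 4 * (ι 3 * f 9 + ι 5)
      ≈⟨ +-congˡ (*-congˡ 3*f9+5≈8*f4) ⟩
    ι 8 * f 4 + ι 4 * (ι 8 * f 4)
      ≈⟨ solve 1 (λ u → num 8 :* u :+ num 4 :* (num 8 :* u) := num 8 :* ((con 1 :+ num 4) :* u)) refl (f 4) ⟩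
    ι 8 * ((1# + ι 4) * f 4) ∎)

  f4≈1⊎f4≈4 : f 4 ≈ 1# ⊎ f 4 ≈ ι 4
  f4≈1⊎f4≈4 = x*x+a*b≈[a+b]*x⇒x≈a⊎x≈b f4-quadratic

  f-lead-units : ∀ x → 0 < x → (as : Vec ℕ i) → All (0 <_) as → All (λ a → f (a ^ 2) ≈ 1#) as →
                 ∀ p → 0 < p → f (p ^ 2) ≈ 1# → suc (i ℕ.+ t) ≡ 6 ℕ.+ n →
                 f (x ^ 2 ℕ.+ (sumSq as ℕ.+ t ℕ.* p ^ 2)) ≈ f (x ^ 2) + ι (i ℕ.+ t)
  f-lead-units {i} {t} x x>0 as as>0 as-units p p>0 fp≈1 eq = begin
    f (x ^ 2 ℕ.+ (sumSq as ℕ.+ t ℕ.* p ^ 2))  ≡⟨ ≡.cong f (ℕₚ.+-assoc (x ^ 2) _ _) ⟨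
    f (sumSq (x ∷ as) ℕ.+ t ℕ.* p ^ 2)        ≈⟨ f-padded-units (x ∷ as) (x>0 ∷ as>0) p p>0 fp≈1 eq ⟩
    f (x ^ 2) + sumFSq as + ι t               ≈⟨ +-assoc _ _ _ ⟩
    f (x ^ 2) + (sumFSq as + ι t)             ≈⟨ +-congˡ (+-congʳ (sumFSq-units as-units)) ⟩
    f (x ^ 2) + (ι i + ι t)                   ≈⟨ +-congˡ (fromℕ-+ R i t) ⟨
    f (x ^ 2) + ι (i ℕ.+ t)                   ∎

  module _ (f4≈1 : f 4 ≈ 1#) where
    private
      f9≈1 : f 9 ≈ 1#
      f9≈1 = *-cancelˡ-fromℕ-suc 2 (∙-cancelʳ (ι 5) _ _ (begin
        ι 3 * f 9 + ι 5  ≈⟨ 3*f9+5≈8*f4 ⟩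
        ι 8 * f 4        ≈⟨ *-congˡ f4≈1 ⟩
        ι 8 * 1#         ≈⟨ solve 0 (num 8 :* con 1 := num 3 :* con 1 :+ num 5) refl ⟩
        ι 3 * 1# + ι 5   ∎))

      f16≈1 : f 16 ≈ 1#
      f16≈1 = ∙-cancelʳ (ι 4) _ _ (begin
        f 16 + ι 4  ≈⟨ f16+4≈5*f4 ⟩
        ι 5 * f 4   ≈⟨ *-congˡ f4≈1 ⟩
        ι 5 * 1#    ≈⟨ solve 0 (num 5 :* con 1 := con 1 :+ num 4) refl ⟩
        1# + ι 4    ∎)

      f36≈1 : f 36 ≈ 1#
      f36≈1 = trans f36≈f4*f9 (trans (*-cong f4≈1 f9≈1) (*-identityˡ 1#))

      f-unit-sum : (as : Vec ℕ i) → All (0 <_) as → All (λ a → f (a ^ 2) ≈ 1#) as →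
                   i ℕ.+ t ≡ 6 ℕ.+ n →
                   f (sumSq as ℕ.+ t) ≈ ι (6 ℕ.+ n)
      f-unit-sum {i} {t} as as>0 as-units i+t≡6+n = begin
        f (sumSq as ℕ.+ t)  ≈⟨ f-padded-ones as as>0 i+t≡6+n ⟩
        sumFSq as + ι t     ≈⟨ +-congʳ (sumFSq-units as-units) ⟩
        ι i + ι t           ≈⟨ fromℕ-+ R i t ⟨
        ι (i ℕ.+ t)         ≡⟨ ≡.cong ι i+t≡6+n ⟩
        ι (6 ℕ.+ n)         ∎

      X : ℕ
      X = 20 ℕ.+ n

      fX≈6+n : f X ≈ ι (6 ℕ.+ n)
      fX≈6+n = f-unit-sum (3 ∷ 2 ∷ 2 ∷ []) positive (f9≈1 ∷ f4≈1 ∷ f4≈1 ∷ []) ≡.refl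

      f[1+X]≈6+n : f (1 ℕ.+ X) ≈ ι (6 ℕ.+ n)
      f[1+X]≈6+n = f-unit-sum (4 ∷ []) positive (f16≈1 ∷ []) ≡.refl

      f[2+X]≈6+n : f (2 ℕ.+ X) ≈ ι (6 ℕ.+ n)
      f[2+X]≈6+n = f-unit-sum (3 ∷ 3 ∷ []) positive (f9≈1 ∷ f9≈1 ∷ []) ≡.refl

      f[3+X]≈6+n : f (3 ℕ.+ X) ≈ ι (6 ℕ.+ n)
      f[3+X]≈6+n =
        f-unit-sum (3 ∷ 2 ∷ 2 ∷ 2 ∷ []) positive (f9≈1 ∷ f4≈1 ∷ f4≈1 ∷ f4≈1 ∷ []) ≡.refl

      n*1≡n : n ℕ.* 1 ≡ n
      n*1≡n = ℕₚ.*-identityʳ n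

      f[X*[1+X]]≈f[X^2]+5+n : f (X ℕ.* (1 ℕ.+ X)) ≈ f (X ^ 2) + ι (5 ℕ.+ n)
      f[X*[1+X]]≈f[X^2]+5+n = trans
        (f-cong (≡.trans (x*[1+x]≡x^2+x X) (≡.cong (λ m → X ^ 2 ℕ.+ (20 ℕ.+ m)) (≡.sym n*1≡n))))
        (f-lead-units X (s≤s z≤n) (4 ∷ []) positive (f16≈1 ∷ []) 1 (s≤s z≤n) f1≈1 ≡.refl)

      f[[2+X]*[3+X]]≈f[[2+X]^2]+5+n : f ((2 ℕ.+ X) ℕ.* (3 ℕ.+ X)) ≈ f ((2 ℕ.+ X) ^ 2) + ι (5 ℕ.+ n)
      f[[2+X]*[3+X]]≈f[[2+X]^2]+5+n = trans
        (f-cong (≡.trans (x*[1+x]≡x^2+x (2 ℕ.+ X))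
                         (≡.cong (λ m → (2 ℕ.+ X) ^ 2 ℕ.+ (22 ℕ.+ m)) (≡.sym n*1≡n))))
        (f-lead-units (2 ℕ.+ X) (s≤s z≤n) (3 ∷ 2 ∷ 2 ∷ 2 ∷ []) positive
                      (f9≈1 ∷ f4≈1 ∷ f4≈1 ∷ f4≈1 ∷ []) 1 (s≤s z≤n) f1≈1 ≡.refl)

      f[[2+X]^2]≈f[X^2]+5+n : f ((2 ℕ.+ X) ^ 2) ≈ f (X ^ 2) + ι (5 ℕ.+ n)
      f[[2+X]^2]≈f[X^2]+5+n = trans (f-cong ([2+x]^2≡x^2+[4+x*4] X))
        (f-lead-units X (s≤s z≤n) (6 ∷ 6 ∷ []) positive (f36≈1 ∷ f36≈1 ∷ [])
                      2 (s≤s z≤n) f4≈1 ≡.refl)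

    5+n≈0 : ι (5 ℕ.+ n) ≈ 0#
    5+n≈0 = ∙-cancelˡ (f (X ^ 2) + ι (5 ℕ.+ n)) _ _ (begin
      f (X ^ 2) + ι (5 ℕ.+ n) + ι (5 ℕ.+ n)  ≈⟨ +-congʳ f[[2+X]^2]≈f[X^2]+5+n ⟨
      f ((2 ℕ.+ X) ^ 2) + ι (5 ℕ.+ n)        ≈⟨ f[[2+X]*[3+X]]≈f[[2+X]^2]+5+n ⟨
      f ((2 ℕ.+ X) ℕ.* (3 ℕ.+ X))            ≈⟨ f-consecutive (2 ℕ.+ X) (s≤s z≤n) ⟩
      f (2 ℕ.+ X) * f (3 ℕ.+ X)              ≈⟨ *-cong f[2+X]≈6+n f[3+X]≈6+n ⟩
      ι (6 ℕ.+ n) * ι (6 ℕ.+ n)              ≈⟨ *-cong fX≈6+n f[1+X]≈6+n ⟨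
      f X * f (1 ℕ.+ X)                      ≈⟨ f-consecutive X (s≤s z≤n) ⟨
      f (X ℕ.* (1 ℕ.+ X))                    ≈⟨ f[X*[1+X]]≈f[X^2]+5+n ⟩
      f (X ^ 2) + ι (5 ℕ.+ n)                ≈⟨ +-identityʳ _ ⟨
      f (X ^ 2) + ι (5 ℕ.+ n) + 0#           ∎)

  f4≉1 : ¬ (f 4 ≈ 1#)
  f4≉1 f4≈1 = fromℕ-suc≉0 (4 ℕ.+ n) (5+n≈0 f4≈1)

  f4≈4 : f 4 ≈ ι 4
  f4≈4 = [ ⊥-elim ∘ f4≉1 , id ]′ f4≈1⊎f4≈4

  f9≈9 : f 9 ≈ ι 9
  f9≈9 = *-cancelˡ-fromℕ-suc 2 (∙-cancelʳ (ι 5) _ _ (begin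
    ι 3 * f 9 + ι 5  ≈⟨ 3*f9+5≈8*f4 ⟩
    ι 8 * f 4        ≈⟨ *-congˡ f4≈4 ⟩
    ι 8 * ι 4        ≈⟨ solve 0 (num 8 :* num 4 := num 3 :* num 9 :+ num 5) refl ⟩
    ι 3 * ι 9 + ι 5  ∎))

  f16≈16 : f 16 ≈ ι 16
  f16≈16 = ∙-cancelʳ (ι 4) _ _ (begin
    f 16 + ι 4  ≈⟨ f16+4≈5*f4 ⟩
    ι 5 * f 4   ≈⟨ *-congˡ f4≈4 ⟩
    ι 5 * ι 4   ≈⟨ solve 0 (num 5 :* num 4 := num 16 :+ num 4) refl ⟩
    ι 16 + ι 4  ∎)

mainTheorem6 : ∀ {c ℓ} (R : CommutativeRing c ℓ) → IsCharZeroDomain R →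
    (k : ℕ) → 6 ≤ k →
    (f : ℕ → CommutativeRing.Carrier R) →
    Multiplicative R f → SumOfSquaresAdditive R k f →
    (CommutativeRing._≈_ R (f (2 ^ 2)) (fromℕ R (2 ^ 2)))
      × (CommutativeRing._≈_ R (f (3 ^ 2)) (fromℕ R (3 ^ 2)))
      × (CommutativeRing._≈_ R (f (4 ^ 2)) (fromℕ R (4 ^ 2)))
mainTheorem6 R D _ (s≤s (s≤s (s≤s (s≤s (s≤s (s≤s {n = n} z≤n)))))) f multiplicative additive =
  f4≈4 , f9≈9 , f16≈16
  where open FirstValues R D f multiplicative n additive
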